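{- Let $\mathcal D$ be a commutative variety of algebras or ordered algebras, $X,Y\in\mathcal D$, and let $(Q,\delta,i,f)$ be a $\mathcal D$-automaton. Then the language $L_Q:X^*\to Y$ accepted by it is recognized by the $\mathcal D$-monoid morphism $e_{T(Q)}:X^*\to T(Q)$ onto its transition $\mathcal D$-monoid.
   Context: A commutative variety $\mathcal D$ is a variety of (ordered) $\Sigma$-algebras such that for all $A,B$ the set $[A,B]$ of homomorphisms is a subalgebra of $B^{|A|}$. $A\otimes B$ represents bimorphisms; $I$ is the free algebra on one generator; $(\mathcal D,\otimes,I)$ is symmetric monoidal closed with internal hom $[A,B]$. A $\mathcal D$-monoid is an object with a monoid structure whose multiplication is a bimorphism; $X^*$ is the free $\mathcal D$-monoid on $X$; a language is a morphism $X^*\to Y$. Elements of $A$ are identified with morphisms $I\to A$. A $\mathcal D$-automaton $(Q,\delta,i,f)$ consists of an object $Q$ and morphisms $\delta:X\otimes Q\to Q$, $i:I\to Q$, $f:Q\to Y$. $[Q,Q]$ is a $\mathcal D$-monoid under composition and identity; $(\lambda\delta)^+:X^*\to[Q,Q]$ is the unique $\mathcal D$-monoid morphism extending the curried $\lambda\delta:X\to[Q,Q]$; write $\delta_x=(\lambda\delta)^+(x)$. The accepted language is $L_Q(x)=f(\delta_x(i))$. The transition $\mathcal D$-monoid $T(Q)$ is the image of $(\lambda\delta)^+$: $(\lambda\delta)^+=m_{T(Q)}\circ e_{T(Q)}$ with $e_{T(Q)}:X^*\to T(Q)$ a surjective $\mathcal D$-monoid morphism and $m_{T(Q)}$ injective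 (order-reflecting in the ordered case). A $\mathcal D$-monoid morphism $e:X^*\to M$ recognizes $L$ if $L=g\circ e$ for some morphism $g:M\to Y$ of $\mathcal D$. -}

module Defs where

open import Level using (0ℓ)
open import Data.Nat using (ℕ)
open import Data.Fin using (Fin)
open import Data.Bool using (Bool; true; false)
open import Data.Unit using (⊤)
open import Data.Product using (Σ; _×_; _,_; proj₁; proj₂; ∃)
open import Relation.Binary.Core using (Rel)
open import Relation.Binary.Structures using (IsPartialOrder)
open import Relation.Binary.PropositionalEquality using (_≡_)

record Signature : Set₁ where
  field
    Op : Set
    ar : Op → ℕ
open Signature public

-- An ordered Σ-algebra: a poset with monotone operations.
-- (Unordered algebras are represented with the discrete order, see Variety.)
record Alg (S : Signature) : Set₁ where
  field
    Carrier : Set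
    _≤_     : Rel Carrier 0ℓ
    isPO    : IsPartialOrder _≡_ _≤_
    op      : (o : Op S) → (Fin (ar S o) → Carrier) → Carrier
    op-mono : ∀ o {as bs : Fin (ar S o) → Carrier} →
              (∀ k → as k ≤ bs k) → op o as ≤ op o bs
open Alg public

record IsHom {S : Signature} (A B : Alg S) (h : Carrier A → Carrier B) : Set where
  field
    preserves : ∀ o (as : Fin (ar S o) → Carrier A) →
                h (op A o as) ≡ op B o (λ k → h (as k))
    mono      : ∀ {a a'} → _≤_ A a a' → _≤_ B (h a) (h a')

Hom : {S : Signature} → Alg S → Alg S → Set
Hom A B = Σ (Carrier A → Carrier B) (IsHom A B)

data Term (S : Signature) : Set where
  var : ℕ → Term S
  app : (o : Op S) → (Fin (ar S o) → Term S) → Term S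

eval : {S : Signature} (A : Alg S) → (ℕ → Carrier A) → Term S → Carrier A
eval A ρ (var n)    = ρ n
eval A ρ (app o ts) = op A o (λ k → eval A ρ (ts k))

-- A variety: either a variety of algebras (discrete = true; equations s = t
-- are given as the two inequations s ≤ t, t ≤ s, and algebras carry the
-- discrete order) or a variety of ordered algebras (discrete = false,
-- presented by inequations).
record Variety (S : Signature) : Set₁ where
  field
    discrete : Bool
    Ineq     : Set
    lhs rhs  : Ineq → Term S
open Variety public

DiscreteIf : Bool → {S : Signature} → Alg S → Set
DiscreteIf true  A = ∀ a b → _≤_ A a b → a ≡ b
DiscreteIf false A = ⊤

InVar : {S : Signature} → Variety S → Alg S → Set
InVar V A = DiscreteIf (discrete V) A ×
            (∀ (e : Ineq V) (ρ : ℕ → Carrier A) →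
               _≤_ A (eval A ρ (lhs V e)) (eval A ρ (rhs V e)))

pw : {S : Signature} (A B : Alg S) (o : Op S) →
     (Fin (ar S o) → Hom A B) → Carrier A → Carrier B
pw A B o hs a = op B o (λ k → proj₁ (hs k) a)

-- Commutative variety: for all A, B in D, [A,B] is closed under the
-- pointwise operations of B^{|A|}, i.e. is a subalgebra.
Commutative : {S : Signature} → Variety S → Set₁
Commutative {S} V = ∀ (A B : Alg S) → InVar V A → InVar V B →
  ∀ (o : Op S) (hs : Fin (ar S o) → Hom A B) → IsHom A B (pw A B o hs)

-- Bimorphisms A × B → C (= morphisms A ⊗ B → C).
IsBimorphism : {S : Signature} (A B C : Alg S) →
               (Carrier A → Carrier B → Carrier C) → Set
IsBimorphism A B C g = (∀ a → IsHom B C (g a)) × (∀ b → IsHom A C (λ a → g a b))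

record DMonoid {S : Signature} (V : Variety S) : Set₁ where
  field
    alg   : Alg S
    inV   : InVar V alg
    mul   : Carrier alg → Carrier alg → Carrier alg
    unit  : Carrier alg
    bimor : IsBimorphism alg alg alg mul
    assoc : ∀ a b c → mul (mul a b) c ≡ mul a (mul b c)
    idˡ   : ∀ a → mul unit a ≡ a
    idʳ   : ∀ a → mul a unit ≡ a
open DMonoid public

U : {S : Signature} {V : Variety S} → DMonoid V → Set
U M = Carrier (alg M)

IsDMonHom : {S : Signature} {V : Variety S} (M N : DMonoid V) → (U M → U N) → Set
IsDMonHom M N h = IsHom (alg M) (alg N) h ×
                  (h (unit M) ≡ unit N) ×
                  (∀ a b → h (mul M a b) ≡ mul N (h a) (h b))

IsFreeDMonoid : {S : Signature} (V : Variety S) (X : Alg S) (M : DMonoid V) →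
                Hom X (alg M) → Set₁
IsFreeDMonoid V X M η = ∀ (N : DMonoid V) (h : Hom X (alg N)) →
  Σ (U M → U N) λ g → IsDMonHom M N g × (∀ x → g (proj₁ η x) ≡ proj₁ h x) ×
    (∀ g' → IsDMonHom M N g' → (∀ x → g' (proj₁ η x) ≡ proj₁ h x) → ∀ m → g' m ≡ g m)

-- D-monoid morphisms M → [Q,Q], where [Q,Q] is the D-monoid of
-- endomorphisms of Q (operations and order pointwise, multiplication =
-- composition, unit = identity); written out pointwise on the underlying
-- functions (equality of elements of [Q,Q] is pointwise equality).
record IsDMonHomToEnd {S : Signature} {V : Variety S} (Q : Alg S) (M : DMonoid V)
                      (φ : U M → Carrier Q → Carrier Q) : Set where
  field
    into-hom : ∀ m → IsHom Q Q (φ m)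
    pres-op  : ∀ o (ms : Fin (ar S o) → U M) q →
               φ (op (alg M) o ms) q ≡ op Q o (λ k → φ (ms k) q)
    mono     : ∀ {m m'} → _≤_ (alg M) m m' → ∀ q → _≤_ Q (φ m q) (φ m' q)
    pres-unit : ∀ q → φ (unit M) q ≡ q
    pres-mul  : ∀ m m' q → φ (mul M m m') q ≡ φ m (φ m' q)

OrderReflectingEnd : {S : Signature} {V : Variety S} (Q : Alg S) (M : DMonoid V) →
                     (U M → Carrier Q → Carrier Q) → Set
OrderReflectingEnd Q M m =
  ∀ t t' → (∀ q → _≤_ Q (m t q) (m t' q)) → _≤_ (alg M) t t'

SurjectiveMap : {A B : Set} → (A → B) → Set
SurjectiveMap {A} {B} e = ∀ (b : B) → ∃ λ (a : A) → e a ≡ b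

-- D-automata (Q, δ, i, f) with δ : X ⊗ Q → Q given as a bimorphism.
record Automaton {S : Signature} (V : Variety S) (X Y : Alg S) : Set₁ where
  field
    Q     : Alg S
    Q∈V   : InVar V Q
    δ     : Carrier X → Carrier Q → Carrier Q
    δ-bi  : IsBimorphism X Q Q δ
    i     : Carrier Q
    f     : Hom Q Y
open Automaton public

-- Accepted language L_Q(w) = f(δ_w(i)), where δ_- = (λδ)^+ is given by φ.
accepted : {S : Signature} {V : Variety S} {X Y : Alg S} (A : Automaton V X Y)
           {M : DMonoid V} → (U M → Carrier (Q A) → Carrier (Q A)) → U M → Carrier Y
accepted A φ w = proj₁ (f A) (φ w (i A))

Recognizes : {S : Signature} {V : Variety S} {Y : Alg S} {N M : DMonoid V} →
             (U N → U M) → (U N → Carrier Y) → Set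
Recognizes {Y = Y} {M = M} e L = Σ (Hom (alg M) Y) λ g → ∀ w → L w ≡ proj₁ g (e w)

module Submission where

-- The accepted language L_Q(w) = f (δ_w i) factors through the transition
-- D-monoid T(Q): since (λδ)^+ = m_T ∘ e_T, we have L_Q = (f ∘ ev_i ∘ m_T) ∘ e_T,
-- where ev_i : [Q,Q] → Q evaluates an endomorphism at the initial state.
-- It only remains to see that g = f ∘ ev_i ∘ m_T : T(Q) → Y is a morphism of D.
--
-- Proposition 4.3 is the instance e = e_T, m = m_T.

open import Defs
open import Data.Product using (_,_; proj₁; proj₂)
open import Function using (_∘_)
open import Relation.Binary.PropositionalEquality
  using (_≡_; cong; module ≡-Reasoning)

∘-isHom : {S : Signature} {A B C : Alg S}
          (h : Carrier B → Carrier C) (k : Carrier A → Carrier B) →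
          IsHom B C h → IsHom A B k → IsHom A C (h ∘ k)
∘-isHom {A = A} {B} {C} h k hh kh = record
  { preserves = preserves-∘
  ; mono      = IsHom.mono hh ∘ IsHom.mono kh
  }
  where
  open ≡-Reasoning
  preserves-∘ : ∀ o as → h (k (op A o as)) ≡ op C o (λ j → h (k (as j)))
  preserves-∘ o as = begin
    h (k (op A o as))             ≡⟨ cong h (IsHom.preserves kh o as) ⟩
    h (op B o (λ j → k (as j)))   ≡⟨ IsHom.preserves hh o (λ j → k (as j)) ⟩
    op C o (λ j → h (k (as j)))   ∎

-- Evaluating a D-monoid morphism m : M → [Q,Q] at a fixed state q gives a
-- homomorphism M → Q, because [Q,Q] carries the pointwise structure.
evalAt-isHom : {S : Signature} {V : Variety S} (Q : Alg S) (M : DMonoid V)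
               (m : U M → Carrier Q → Carrier Q) → IsDMonHomToEnd Q M m →
               (q : Carrier Q) → IsHom (alg M) Q (λ t → m t q)
evalAt-isHom Q M m mh q = record
  { preserves = λ o ts → IsDMonHomToEnd.pres-op mh o ts q
  ; mono      = λ t≤t' → IsDMonHomToEnd.mono mh t≤t' q
  }

recognizes-via-end : {S : Signature} {V : Variety S} {X Y : Alg S}
                     (A : Automaton V X Y) (N M : DMonoid V)
                     (φ : U N → Carrier (Q A) → Carrier (Q A))
                     (e : U N → U M) (m : U M → Carrier (Q A) → Carrier (Q A)) →
                     IsDMonHomToEnd (Q A) M m →
                     (∀ w q → φ w q ≡ m (e w) q) →
                     Recognizes {Y = Y} {N = N} {M = M} e (accepted A {M = N} φ)
recognizes-via-end {Y = Y} A N M φ e m mh φ≡m∘e = (g , g-isHom) , factorisation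
  where
  g : U M → Carrier Y
  g t = proj₁ (f A) (m t (i A))

  g-isHom : IsHom (alg M) Y g
  g-isHom = ∘-isHom (proj₁ (f A)) (λ t → m t (i A))
                    (proj₂ (f A)) (evalAt-isHom (Q A) M m mh (i A))

  factorisation : ∀ w → accepted A {M = N} φ w ≡ g (e w)
  factorisation w = cong (proj₁ (f A)) (φ≡m∘e w (i A))

proposition4p3 : (S : Signature) (V : Variety S) → Commutative V →
    (X Y : Alg S) → InVar V X → InVar V Y →
    (A : Automaton V X Y) →
    (X* : DMonoid V) (η : Hom X (alg X*)) → IsFreeDMonoid V X X* η →
    (φ : U X* → Carrier (Q A) → Carrier (Q A)) → IsDMonHomToEnd (Q A) X* φ →
    (∀ x q → φ (proj₁ η x) q ≡ δ A x q) →
    (T : DMonoid V) (e : U X* → U T) → IsDMonHom X* T e → SurjectiveMap e →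
    (m : U T → Carrier (Q A) → Carrier (Q A)) → IsDMonHomToEnd (Q A) T m →
    OrderReflectingEnd (Q A) T m →
    (∀ w q → φ w q ≡ m (e w) q) →
    Recognizes {Y = Y} {N = X*} {M = T} e (accepted A {M = X*} φ)
proposition4p3 S V _ X Y _ _ A X* η _ φ _ _ T e _ _ m m-hom _ φ≡m∘e =
  recognizes-via-end A X* T φ e m m-hom φ≡m∘e
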